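{- Let $G$ be the directed graph with vertex set $\mathcal{D}$ and with an edge from $d$ to each of $4d-1$, $4d+1$, $4d+3$ for every $d \in \mathcal{D}$. Then all these endpoints lie in $\mathcal{D}$, and $G$ is a forest of infinite directed rooted ternary trees: every vertex has exactly three out-neighbours, every vertex has at most one in-neighbour, and $G$ contains no directed cycle. Moreover, the number of trees in this forest (equivalently, the number of vertices with no in-neighbour) is infinite.
   Context: Let $\mathcal{D}$ (OEIS A036991) be the set of positive integers $m$ such that, in the binary expansion of $m$ written without leading zeros, every suffix contains at least as many digits $1$ as digits $0$. -}

module Defs where

open import Data.Nat using (ℕ; zero; suc; _+_; _*_; _∸_; _≤_; ⌊_/2⌋)
open import Data.Nat.Base using (_%_)
open import Data.Bool using (Bool; true; false)
open import Data.List using (List; []; _∷_; take)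
open import Data.Product using (_×_; ∃-syntax)
open import Data.Sum using (_⊎_)
open import Data.Empty using (⊥)
open import Relation.Nullary using (¬_)
open import Relation.Binary.PropositionalEquality using (_≡_)
open import Relation.Binary.Construct.Closure.Transitive using (TransClosure)

-- Binary digits of n, least significant first (true = digit 1),
-- without leading zeros (so bits 0 = []).  The fuel argument is
-- always ≥ the number of digits when called as bitsAux n n.
bitsAux : ℕ → ℕ → List Bool
bitsAux zero    _       = []
bitsAux (suc f) zero    = []
bitsAux (suc f) (suc n) = isOdd (suc n) ∷ bitsAux f ⌊ suc n /2⌋
  where
  isOdd : ℕ → Bool
  isOdd m with m % 2
  ... | zero = false
  ... | suc _ = true

bits : ℕ → List Bool
bits n = bitsAux n n

ones : List Bool → ℕ
ones []           = 0
ones (true  ∷ bs) = suc (ones bs)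
ones (false ∷ bs) = ones bs

zeros : List Bool → ℕ
zeros []           = 0
zeros (true  ∷ bs) = zeros bs
zeros (false ∷ bs) = suc (zeros bs)

-- Suffixes of the (MSB-first) binary string are the prefixes of the
-- LSB-first digit list.
InD : ℕ → Set
InD m = (1 ≤ m) × (∀ k → zeros (take k (bits m)) ≤ ones (take k (bits m)))

Edge : ℕ → ℕ → Set
Edge d e = InD d × ((e ≡ 4 * d ∸ 1) ⊎ (e ≡ 4 * d + 1) ⊎ (e ≡ 4 * d + 3))

Path⁺ : ℕ → ℕ → Set
Path⁺ = TransClosure Edge

Root : ℕ → Set
Root r = InD r × (∀ d → ¬ Edge d r)

-- Members of D are odd. Appending binary digits, 4d + 3 = d·11 and 4d + 1 = d·01,
-- and for d = 1 + 2a also 4d − 1 = (2a)·11, so the suffix condition is preserved.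
-- The children of 1 + 2a are 8a + 3, 8a + 5 and 8a + 7, hence a vertex e can only be
-- the child of 1 + 2⌊e/8⌋, and edges increase, which excludes cycles. Finally
-- 32u + 7 = u·00111 lies in D for u ∈ D, while its only candidate parent
-- 1 + 2·4u = u·001 does not, so these are roots.
module Submission where

open import Data.Bool using (Bool; true; false)
open import Data.Empty using (⊥-elim)
open import Data.List using (List; []; _∷_; take)
open import Data.Nat using (ℕ; zero; suc; _+_; _*_; _∸_; _≤_; _<_; _<?_; _≤?_; NonZero; _/_; _%_; ⌊_/2⌋; z≤n; s≤s)
open import Data.Nat.Properties
open import Data.Nat.DivMod using (m≡m%n+[m/n]*n; m%n<n; m*n/n≡m; m<n⇒m/n≡0; +-distrib-/-∣ʳ; [m+kn]%n≡m%n; m*n%n≡0)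
open import Data.Nat.Divisibility using (divides-refl)
open import Data.Nat.Tactic.RingSolver using (solve-∀)
open import Data.Product using (_×_; ∃-syntax; _,_; proj₂)
open import Data.Sum using (_⊎_; inj₁; inj₂)
open import Function using (_∘_)
open import Relation.Binary.Construct.Closure.Transitive using ([_]; _∷_)
open import Relation.Binary.PropositionalEquality using (_≡_; _≢_; refl; sym; trans; cong; cong₂; subst; module ≡-Reasoning)
open import Relation.Nullary using (¬_)
open import Relation.Nullary.Decidable using (from-yes)

open import Defs

⌊n/2⌋≤pred : ∀ n → ⌊ suc n /2⌋ ≤ n
⌊n/2⌋≤pred n = ≤-pred (⌊n/2⌋<n n)

bitsAux-fuel : ∀ {f g n} → n ≤ f → n ≤ g → bitsAux f n ≡ bitsAux g n
bitsAux-fuel {zero}  {zero}  {zero} _ _ = refl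
bitsAux-fuel {zero}  {suc _} {zero} _ _ = refl
bitsAux-fuel {suc _} {zero}  {zero} _ _ = refl
bitsAux-fuel {suc _} {suc _} {zero} _ _ = refl
bitsAux-fuel {suc f} {suc g} {suc n} (s≤s n≤f) (s≤s n≤g) with suc n % 2
... | zero  = cong (false ∷_) (bitsAux-fuel (≤-trans (⌊n/2⌋≤pred n) n≤f) (≤-trans (⌊n/2⌋≤pred n) n≤g))
... | suc _ = cong (true ∷_)  (bitsAux-fuel (≤-trans (⌊n/2⌋≤pred n) n≤f) (≤-trans (⌊n/2⌋≤pred n) n≤g))

bits-suc-odd : ∀ n → suc n % 2 ≡ 1 → bits (suc n) ≡ true ∷ bits ⌊ suc n /2⌋
bits-suc-odd n odd with suc n % 2 | odd
... | .1 | refl = cong (true ∷_) (bitsAux-fuel (⌊n/2⌋≤pred n) ≤-refl)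

bits-suc-even : ∀ n → suc n % 2 ≡ 0 → bits (suc n) ≡ false ∷ bits ⌊ suc n /2⌋
bits-suc-even n even with suc n % 2 | even
... | .0 | refl = cong (false ∷_) (bitsAux-fuel (⌊n/2⌋≤pred n) ≤-refl)

[1+2n]%2≡1 : ∀ n → (1 + 2 * n) % 2 ≡ 1
[1+2n]%2≡1 n = trans (cong (λ m → (1 + m) % 2) (*-comm 2 n)) ([m+kn]%n≡m%n 1 n 2)

[2n]%2≡0 : ∀ n → (2 * n) % 2 ≡ 0
[2n]%2≡0 n = trans (cong (_% 2) (*-comm 2 n)) (m*n%n≡0 n 2)

⌊1+2n/2⌋≡n : ∀ n → ⌊ 1 + 2 * n /2⌋ ≡ n
⌊1+2n/2⌋≡n zero    = refl
⌊1+2n/2⌋≡n (suc n) rewrite +-suc n (n + 0) = cong suc (⌊1+2n/2⌋≡n n)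

⌊2n/2⌋≡n : ∀ n → ⌊ 2 * n /2⌋ ≡ n
⌊2n/2⌋≡n zero    = refl
⌊2n/2⌋≡n (suc n) rewrite +-suc n (n + 0) = cong suc (⌊2n/2⌋≡n n)

bits-1+2n : ∀ n → bits (1 + 2 * n) ≡ true ∷ bits n
bits-1+2n n = trans (bits-suc-odd (2 * n) ([1+2n]%2≡1 n)) (cong (λ m → true ∷ bits m) (⌊1+2n/2⌋≡n n))

bits-2n : ∀ {n} → 1 ≤ n → bits (2 * n) ≡ false ∷ bits n
bits-2n {n@(suc _)} _ = trans (bits-suc-even _ ([2n]%2≡0 n)) (cong (λ m → false ∷ bits m) (⌊2n/2⌋≡n n))

-- InD m is definitionally 1 ≤ m × Ballot 0 (bits m): the prefixes of the
-- least-significant-first digit list are the suffixes of the binary word.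
Ballot : ℕ → List Bool → Set
Ballot s l = ∀ k → zeros (take k l) ≤ s + ones (take k l)

[]-ballot : ∀ {s} → Ballot s []
[]-ballot zero    = z≤n
[]-ballot (suc k) = z≤n

ballot-mono : ∀ {s t l} → s ≤ t → Ballot s l → Ballot t l
ballot-mono s≤t b k = ≤-trans (b k) (+-monoˡ-≤ _ s≤t)

true∷-ballot : ∀ {s l} → Ballot (suc s) l → Ballot s (true ∷ l)
true∷-ballot b zero = z≤n
true∷-ballot {s} {l} b (suc k) = subst (zeros (take k l) ≤_) (sym (+-suc s (ones (take k l)))) (b k)

true∷-ballot⁻ : ∀ {s l} → Ballot s (true ∷ l) → Ballot (suc s) l
true∷-ballot⁻ {s} {l} b k = subst (zeros (take k l) ≤_) (+-suc s (ones (take k l))) (b (suc k))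

false∷-ballot : ∀ {s l} → Ballot s l → Ballot (suc s) (false ∷ l)
false∷-ballot b zero    = z≤n
false∷-ballot b (suc k) = s≤s (b k)

false∷-ballot⁻ : ∀ {s l} → Ballot (suc s) (false ∷ l) → Ballot s l
false∷-ballot⁻ b k = ≤-pred (b (suc k))

¬ballot₀-false∷ : ∀ {l} → ¬ Ballot 0 (false ∷ l)
¬ballot₀-false∷ b with b 1
... | ()

ballot-double : ∀ {s} n → Ballot s (bits n) → Ballot (suc s) (bits (2 * n))
ballot-double zero    _ = []-ballot
ballot-double (suc n) b = subst (Ballot _) (sym (bits-2n (s≤s z≤n))) (false∷-ballot b)

ballot-1+2n : ∀ {s} n → Ballot (suc s) (bits n) → Ballot s (bits (1 + 2 * n))
ballot-1+2n n b = subst (Ballot _) (sym (bits-1+2n n)) (true∷-ballot b)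

ballot-1+2n⁻ : ∀ {s} n → Ballot s (bits (1 + 2 * n)) → Ballot (suc s) (bits n)
ballot-1+2n⁻ n b = true∷-ballot⁻ (subst (Ballot _) (bits-1+2n n) b)

InD-1+2n : ∀ {n} → Ballot 1 (bits n) → InD (1 + 2 * n)
InD-1+2n {n} b = s≤s z≤n , ballot-1+2n n b

%2-cases : ∀ m → m % 2 ≡ 0 ⊎ m % 2 ≡ 1
%2-cases m with m % 2 | m%n<n m 2
... | 0           | _ = inj₁ refl
... | 1           | _ = inj₂ refl
... | suc (suc _) | s≤s (s≤s ())

InD⇒odd : ∀ {d} → InD d → ∃[ a ] (d ≡ 1 + 2 * a)
InD⇒odd {suc n} (_ , b) with %2-cases (suc n)
... | inj₁ even = ⊥-elim (¬ballot₀-false∷ (subst (Ballot 0) (bits-suc-even n even) b))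
... | inj₂ odd  = suc n / 2 , (begin
  suc n                     ≡⟨ m≡m%n+[m/n]*n (suc n) 2 ⟩
  suc n % 2 + suc n / 2 * 2 ≡⟨ cong₂ _+_ odd (*-comm (suc n / 2) 2) ⟩
  1 + 2 * (suc n / 2)       ∎)
  where open ≡-Reasoning

InD-4d+3 : ∀ {d} → InD d → InD (4 * d + 3)
InD-4d+3 {d} (_ , b) = subst InD (sym (4d+3≡ d)) (InD-1+2n (ballot-1+2n d (ballot-mono z≤n b)))
  where
  4d+3≡ : ∀ d → 4 * d + 3 ≡ 1 + 2 * (1 + 2 * d)
  4d+3≡ = solve-∀

InD-4d+1 : ∀ {d} → InD d → InD (4 * d + 1)
InD-4d+1 {d} (_ , b) = subst InD (sym (4d+1≡ d)) (InD-1+2n (ballot-double d b))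
  where
  4d+1≡ : ∀ d → 4 * d + 1 ≡ 1 + 2 * (2 * d)
  4d+1≡ = solve-∀

InD-4d∸1 : ∀ {d} → InD d → InD (4 * d ∸ 1)
InD-4d∸1 d∈D with InD⇒odd d∈D
... | a , refl = subst InD (sym (cong (_∸ 1) (4d≡ a)))
  (InD-1+2n (ballot-1+2n (2 * a) (ballot-double a (ballot-1+2n⁻ a (proj₂ d∈D)))))
  where
  4d≡ : ∀ a → 4 * (1 + 2 * a) ≡ 1 + (1 + 2 * (1 + 2 * (2 * a)))
  4d≡ = solve-∀

[r+m*n]/n≡m : ∀ {r} m n .{{_ : NonZero n}} → r < n → (r + m * n) / n ≡ m
[r+m*n]/n≡m {r} m n r<n = begin
  (r + m * n) / n       ≡⟨ +-distrib-/-∣ʳ r (divides-refl m) ⟩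
  r / n + m * n / n     ≡⟨ cong₂ _+_ (m<n⇒m/n≡0 r<n) (m*n/n≡m m n) ⟩
  m                     ∎
  where open ≡-Reasoning

4[1+2a]≡4+a*8 : ∀ a → 4 * (1 + 2 * a) ≡ 4 + a * 8
4[1+2a]≡4+a*8 = solve-∀

Edge-shape : ∀ {d e} → Edge d e → ∃[ a ] ∃[ r ] (d ≡ 1 + 2 * a × e ≡ r + a * 8 × 3 ≤ r × r < 8)
Edge-shape (d∈D , _) with InD⇒odd d∈D
Edge-shape (_ , inj₁ refl)        | a , refl =
  a , 3 , refl , cong (_∸ 1) (4[1+2a]≡4+a*8 a) , ≤-refl , from-yes (3 <? 8)
Edge-shape (_ , inj₂ (inj₁ refl)) | a , refl =
  a , 5 , refl , trans (cong (_+ 1) (4[1+2a]≡4+a*8 a)) (+-comm (4 + a * 8) 1) , from-yes (3 ≤? 5) , from-yes (5 <? 8)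
Edge-shape (_ , inj₂ (inj₂ refl)) | a , refl =
  a , 7 , refl , trans (cong (_+ 3) (4[1+2a]≡4+a*8 a)) (+-comm (4 + a * 8) 3) , from-yes (3 ≤? 7) , ≤-refl

Edge⇒parent : ∀ {d e} → Edge d e → d ≡ 1 + 2 * (e / 8)
Edge⇒parent d→e with Edge-shape d→e
... | a , r , refl , refl , _ , r<8 = cong (λ m → 1 + 2 * m) (sym ([r+m*n]/n≡m a 8 r<8))

Edge⇒< : ∀ {d e} → Edge d e → d < e
Edge⇒< d→e with Edge-shape d→e
... | a , r , refl , refl , 3≤r , _ = +-mono-≤ (≤-trans (from-yes (2 ≤? 3)) 3≤r) (2a≤8a a)
  where
  2a≤8a : ∀ a → 2 * a ≤ a * 8
  2a≤8a a = subst (2 * a ≤_) (*-comm 8 a) (*-monoˡ-≤ a (from-yes (2 ≤? 8)))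

Path⁺⇒< : ∀ {d e} → Path⁺ d e → d < e
Path⁺⇒< [ d→e ]      = Edge⇒< d→e
Path⁺⇒< (d→y ∷ y→⁺e) = <-trans (Edge⇒< d→y) (Path⁺⇒< y→⁺e)

Edge⇒ballot : ∀ {d e} → Edge d e → Ballot 1 (bits (e / 8))
Edge⇒ballot {e = e} d→e@(d∈D , _) = ballot-1+2n⁻ (e / 8) (subst (Ballot 0 ∘ bits) (Edge⇒parent d→e) (proj₂ d∈D))

¬ballot₁-4n : ∀ {n} → 1 ≤ n → ¬ Ballot 1 (bits (2 * (2 * n)))
¬ballot₁-4n {n} 1≤n b = ¬ballot₀-false∷ (false∷-ballot⁻ (subst (Ballot 1) 4n-bits b))
  where
  4n-bits : bits (2 * (2 * n)) ≡ false ∷ false ∷ bits n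
  4n-bits = trans (bits-2n (≤-trans 1≤n (m≤n*m n 2))) (cong (false ∷_) (bits-2n 1≤n))

Root-32u+7 : ∀ {u} → InD u → Root (32 * u + 7)
Root-32u+7 {u} (1≤u , b) = r∈D , no-parent
  where
  r∈D : InD (32 * u + 7)
  r∈D = subst InD (sym (odd-form u))
    (InD-1+2n (ballot-1+2n _ (ballot-1+2n _ (ballot-double (2 * u) (ballot-double u (ballot-mono z≤n b))))))
    where
    odd-form : ∀ u → 32 * u + 7 ≡ 1 + 2 * (1 + 2 * (1 + 2 * (2 * (2 * u))))
    odd-form = solve-∀
  no-parent : ∀ d → ¬ Edge d (32 * u + 7)
  no-parent d d→r = ¬ballot₁-4n 1≤u (subst (Ballot 1 ∘ bits) r/8≡4u (Edge⇒ballot d→r))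
    where
    div-form : ∀ u → 32 * u + 7 ≡ 7 + 2 * (2 * u) * 8
    div-form = solve-∀
    r/8≡4u : (32 * u + 7) / 8 ≡ 2 * (2 * u)
    r/8≡4u = trans (cong (_/ 8) (div-form u)) ([r+m*n]/n≡m (2 * (2 * u)) 8 (from-yes (7 <? 8)))

roots-unbounded : ∀ N → ∃[ r ] (N ≤ r × Root r)
roots-unbounded zero = 39 , z≤n , Root-32u+7 (InD-1+2n {0} []-ballot)
roots-unbounded (suc N) with roots-unbounded N
... | r , N≤r , (r∈D , _) = 32 * r + 7 , ≤-trans (s≤s N≤r) r<32r+7 , Root-32u+7 r∈D
  where
  r<32r+7 : r < 32 * r + 7
  r<32r+7 = ≤-<-trans (m≤n*m r 32) (m<m+n (32 * r) (from-yes (0 <? 7)))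

theorem13 :
    (∀ d → InD d → InD (4 * d ∸ 1) × InD (4 * d + 1) × InD (4 * d + 3))
    × (∀ d → InD d → (4 * d ∸ 1 ≢ 4 * d + 1) × (4 * d ∸ 1 ≢ 4 * d + 3) × (4 * d + 1 ≢ 4 * d + 3))
    × (∀ d d′ e → Edge d e → Edge d′ e → d ≡ d′)
    × (∀ d → ¬ Path⁺ d d)
    × (∀ N → ∃[ r ] (N ≤ r × Root r))
theorem13 =
    (λ _ d∈D → InD-4d∸1 d∈D , InD-4d+1 d∈D , InD-4d+3 d∈D)
  , (λ d _ → <⇒≢ (4d∸1<4d+ d 0) , <⇒≢ (4d∸1<4d+ d 2) , <⇒≢ (+-monoʳ-< (4 * d) (from-yes (1 <? 3))))
  , (λ _ _ _ d→e d′→e → trans (Edge⇒parent d→e) (sym (Edge⇒parent d′→e)))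
  , (λ _ d→⁺d → <-irrefl refl (Path⁺⇒< d→⁺d))
  , roots-unbounded
  where
  4d∸1<4d+ : ∀ d k → 4 * d ∸ 1 < 4 * d + suc k
  4d∸1<4d+ d k = ≤-<-trans (m∸n≤m (4 * d) 1) (m<m+n (4 * d) (s≤s z≤n))
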